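{- Let $n\ge 2$ be an integer and let $Q_{4n}=\langle a,b : a^{n}=b^{2},\ a^{2n}=e,\ b^{ -1}ab=a^{ -1}\rangle$ be the generalized quaternion group of order $4n$. Then $\mathcal{S}^{**}(Q_{4n})$ is the line graph of some graph if and only if $n=2^k$ for some integer $k\ge 1$.
   Context: For a finite group $G$ with identity $e$, the order supergraph $\mathcal{S}(G)$ is the simple undirected graph with vertex set $G$ in which distinct $x,y$ are adjacent if and only if $o(x)\mid o(y)$ or $o(y)\mid o(x)$, where $o(x)$ is the order of $x$. A dominating vertex is a vertex adjacent to all other vertices. $\mathcal{S}^{**}(G)$ is the subgraph of $\mathcal{S}(G)$ obtained by deleting all dominating vertices of $\mathcal{S}(G)$. A graph is a line graph if it is isomorphic to the line graph $L(\Gamma)$ of some simple graph $\Gamma$; the graph with empty vertex set is regarded as a line graph. -}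

module Defs where

open import Data.Nat using (ℕ; zero; suc; _+_; _*_; _∸_; _<_; _≤_; s≤s)
open import Data.Nat.Divisibility using (_∣_)
open import Data.Nat.DivMod using (_mod_)
open import Data.Fin as Fin using (Fin; toℕ)
open import Data.Bool using (Bool; true; false)
open import Data.Product using (Σ; ∃; _×_; _,_; proj₁; proj₂)
open import Data.Sum using (_⊎_)
open import Relation.Nullary using (¬_)
open import Relation.Binary.PropositionalEquality using (_≡_; _≢_)
open import Function.Bundles using (_⇔_)

module GroupNotions (G : Set) (_·_ : G → G → G) (e : G) where

  pow : G → ℕ → G
  pow x zero    = e
  pow x (suc k) = x · pow x k

  IsOrder : G → ℕ → Set
  IsOrder x k = (0 < k) × (pow x k ≡ e) × (∀ m → 0 < m → m < k → pow x m ≢ e)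

  OrdersComparable : G → G → Set
  OrdersComparable x y =
    ∃ λ k → ∃ λ l → IsOrder x k × IsOrder y l × (k ∣ l ⊎ l ∣ k)

  SAdj : G → G → Set
  SAdj x y = (x ≢ y) × OrdersComparable x y

  Dominating : G → Set
  Dominating x = ∀ y → y ≢ x → SAdj x y

  V** : Set
  V** = Σ G λ x → ¬ Dominating x

  _≈**_ : V** → V** → Set
  v ≈** w = proj₁ v ≡ proj₁ w

  Adj** : V** → V** → Set
  Adj** v w = SAdj (proj₁ v) (proj₁ w)

record SimpleGraph : Set₁ where
  field
    Vtx    : Set
    Edge   : Vtx → Vtx → Set
    sym    : ∀ {u v} → Edge u v → Edge v u
    irrefl : ∀ {u} → ¬ Edge u u

SameEdge : {V : Set} → V × V → V × V → Set
SameEdge (u , v) (u' , v') = ((u ≡ u') × (v ≡ v')) ⊎ ((u ≡ v') × (v ≡ u'))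

ShareEnd : {V : Set} → V × V → V × V → Set
ShareEnd (u , v) (u' , v') = (u ≡ u') ⊎ (u ≡ v') ⊎ (v ≡ u') ⊎ (v ≡ v')

-- The graph (W, A) (with vertex equality _≈_) is isomorphic to the line
-- graph L(Γ) of some simple graph Γ: there is a bijection f from W onto
-- the edge set of Γ such that distinct vertices are adjacent iff their
-- images share an endpoint.
IsLineGraph : (W : Set) → (W → W → Set) → (W → W → Set) → Set₁
IsLineGraph W _≈_ A =
  Σ SimpleGraph λ Γ → let open SimpleGraph Γ in
  Σ (W → Vtx × Vtx) λ f →
    (∀ w → Edge (proj₁ (f w)) (proj₂ (f w)))
  × (∀ w w' → SameEdge (f w) (f w') → w ≈ w')
  × (∀ u v → Edge u v → ∃ λ w → SameEdge (f w) (u , v))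
  × (∀ w w' → ¬ (w ≈ w') → (A w w' ⇔ ShareEnd (f w) (f w')))

-- Generalized quaternion group Q_{4n} = ⟨a,b | a^n = b^2, a^{2n} = e, b⁻¹ab = a⁻¹⟩
-- Concrete model: (i , false) represents a^i, (i , true) represents a^i b,
-- with i taken mod 2n.  Multiplication rules (b a^k = a^{-k} b, b^2 = a^n):
--   a^i     · a^k b^l = a^{i+k} b^l
--   a^i b   · a^k     = a^{i-k} b
--   a^i b   · a^k b   = a^{i-k+n}

QElem : ℕ → Set
QElem n = Fin (2 * n) × Bool

qMul : (n : ℕ) → QElem n → QElem n → QElem n
qMul zero    (() , _) _
qMul (suc m) (i , false) (k , l) =
  ((toℕ i + toℕ k) mod (2 * suc m)) , l
qMul (suc m) (i , true) (k , false) =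
  ((toℕ i + (2 * suc m ∸ toℕ k)) mod (2 * suc m)) , true
qMul (suc m) (i , true) (k , true) =
  ((toℕ i + (2 * suc m ∸ toℕ k) + suc m) mod (2 * suc m)) , false

-- identity e = a^0 (defined under the standing hypothesis n ≥ 2)
qId : (n : ℕ) → 2 ≤ n → QElem n
qId (suc m) _ = Fin.zero , false

SQ**IsLineGraph : (n : ℕ) → 2 ≤ n → Set₁
SQ**IsLineGraph n h = IsLineGraph V** _≈**_ Adj**
  where open GroupNotions (QElem n) (qMul n) (qId n h)

{-# OPTIONS --safe #-}
-- In Q₄ₙ the element aʲ has order 2n / gcd(2n, j) and every aⁱb has order 4.
-- If n = 2ᵏ all orders are powers of 2, hence pairwise comparable under
-- divisibility: every vertex of S(Q₄ₙ) is dominating, S** is empty, and the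
-- empty graph is a line graph.  Otherwise n = c d with d odd and d ≥ 3, and
-- the elements aⁿ, b, a^(±c), a^(±2c), of orders 2, 4, 2d, 2d, d, d, induce in
-- S** a configuration that no line graph contains.
module Submission where

open import Defs
open import Data.Nat
open import Data.Nat.Properties
open import Data.Nat.Divisibility
open import Data.Nat.DivMod
open import Data.Nat.GCD using (gcd; gcd[m,n]∣m; gcd[m,n]∣n; gcd[m,n]≢0; m/gcd[m,n]≢0)
open import Data.Nat.Coprimality using (Coprime; coprime-divisor; coprime-/gcd; 1-coprimeTo) renaming (sym to coprime-sym)
open import Data.Nat.Induction using (<-wellFounded)
open import Induction.WellFounded using (Acc; acc)
open import Data.Fin as Fin using (Fin; toℕ)
open import Data.Fin.Properties using (toℕ-injective; toℕ-fromℕ<)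
open import Data.Bool using (true; false)
open import Data.Product
open import Data.Sum as Sum
open import Data.Empty using (⊥)
open import Function.Base using (_∘_)
open import Function.Bundles using (Equivalence; _⇔_; mk⇔)
open import Function.Properties.Equivalence using () renaming (trans to ⇔-trans)
open import Relation.Nullary using (¬_; yes; no; contradiction)
open import Relation.Binary.PropositionalEquality
open import Relation.Binary.Definitions using (tri<; tri≈; tri>)

Comparable : ℕ → ℕ → Set
Comparable k l = k ∣ l ⊎ l ∣ k

2^-comparable : ∀ i j → Comparable (2 ^ i) (2 ^ j)
2^-comparable zero    j       = inj₁ (1∣ _)
2^-comparable (suc i) zero    = inj₂ (1∣ _)
2^-comparable (suc i) (suc j) = Sum.map (*-monoʳ-∣ 2) (*-monoʳ-∣ 2) (2^-comparable i j)

∤⇒coprime-2 : ∀ {d} → 2 ∤ d → Coprime d 2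
∤⇒coprime-2 {d} 2∤d {zero}  (_ , 0∣2) = contradiction (0∣⇒≡0 0∣2) λ ()
∤⇒coprime-2 {d} 2∤d {1}     _         = refl
∤⇒coprime-2 {d} 2∤d {2}     (2∣d , _) = contradiction 2∣d 2∤d
∤⇒coprime-2 {d} 2∤d {suc (suc (suc _))} (_ , c∣2) = contradiction c∣2 (>⇒∤ (s≤s (s≤s (s≤s z≤n))))

coprime-pred : ∀ t .{{_ : NonZero t}} → Coprime t (pred t)
coprime-pred (suc t) {i} (i∣1+t , i∣t) = ∣1⇒≡1 (∣m+n∣m⇒∣n (subst (i ∣_) (+-comm 1 t) i∣1+t) i∣t)

pred[n]<n : ∀ n .{{_ : NonZero n}} → pred n < n
pred[n]<n (suc n) = ≤-refl

2<⇒1≢pred : ∀ {t} → 2 < t → 1 ≢ pred t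
2<⇒1≢pred {2}                   (s≤s (s≤s ()))
2<⇒1≢pred {suc (suc (suc _))} _ ()

∣2^⇒≡2^ : ∀ {d} a → d ∣ 2 ^ a → ∃[ i ] d ≡ 2 ^ i
∣2^⇒≡2^     zero    d∣1 = 0 , ∣1⇒≡1 d∣1
∣2^⇒≡2^ {d} (suc a) d∣2^1+a with 2 ∣? d
... | no  2∤d = ∣2^⇒≡2^ a (coprime-divisor (∤⇒coprime-2 2∤d) d∣2^1+a)
... | yes (divides h refl) =
  let i , h≡2^i = ∣2^⇒≡2^ {h} a (*-cancelˡ-∣ 2 (subst (_∣ 2 ^ suc a) (*-comm h 2) d∣2^1+a))
  in suc i , trans (*-comm h 2) (cong (2 *_) h≡2^i)

2^⊎odd-divisor : ∀ n → 0 < n → (∃[ k ] n ≡ 2 ^ k) ⊎ (∃[ d ] 2 < d × 2 ∤ d × d ∣ n)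
2^⊎odd-divisor n 0<n = go n 0<n (<-wellFounded n)
  where
  odd : ∀ n → 0 < n → 2 ∤ n → (∃[ k ] n ≡ 2 ^ k) ⊎ (∃[ d ] 2 < d × 2 ∤ d × d ∣ n)
  odd 1                   _ _   = inj₁ (0 , refl)
  odd 2                   _ 2∤2 = contradiction ∣-refl 2∤2
  odd n@(suc (suc (suc _))) _ 2∤n = inj₂ (n , s≤s (s≤s (s≤s z≤n)) , 2∤n , ∣-refl)
  go : ∀ n → 0 < n → Acc _<_ n → (∃[ k ] n ≡ 2 ^ k) ⊎ (∃[ d ] 2 < d × 2 ∤ d × d ∣ n)
  go n 0<n (acc rec) with 2 ∣? n
  ... | no 2∤n = odd n 0<n 2∤n
  ... | yes (divides (suc h) refl) =
    Sum.map (λ (k , 1+h≡2^k) → suc k , trans (*-comm (suc h) 2) (cong (2 *_) 1+h≡2^k))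
            (λ (d , 2<d , 2∤d , d∣1+h) → d , 2<d , 2∤d , ∣m⇒∣m*n 2 d∣1+h)
            (go (suc h) z<s (rec (m<m*n (suc h) 2 (s≤s (s≤s z≤n)))))

g*t∣g*u*m⇔t∣m : ∀ {g t u} m .{{_ : NonZero g}} → Coprime t u → g * t ∣ g * u * m ⇔ t ∣ m
g*t∣g*u*m⇔t∣m {g} {t} {u} m t⊥u = mk⇔
  (λ gt∣gum → coprime-divisor t⊥u (*-cancelˡ-∣ g (subst (g * t ∣_) (*-assoc g u m) gt∣gum)))
  (λ t∣m → subst (g * t ∣_) (sym (*-assoc g u m)) (*-monoʳ-∣ g (∣n⇒∣m*n u t∣m)))

[m+n%d]%d≡[m+n]%d : ∀ m n d .{{_ : NonZero d}} → (m + n % d) % d ≡ (m + n) % d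
[m+n%d]%d≡[m+n]%d m n d = begin
  (m + n % d) % d           ≡⟨ %-distribˡ-+ m (n % d) d ⟩
  (m % d + n % d % d) % d   ≡⟨ cong (λ r → (m % d + r) % d) (m%n%n≡m%n n d) ⟩
  (m % d + n % d) % d       ≡⟨ %-distribˡ-+ m n d ⟨
  (m + n) % d               ∎
  where open ≡-Reasoning

n∣m+[n∸m%n] : ∀ m n .{{_ : NonZero n}} → n ∣ m + (n ∸ m % n)
n∣m+[n∸m%n] m n = subst (n ∣_) (sym m+[n∸m%n]≡[m/n]*n+n) (∣m∣n⇒∣m+n (n∣m*n (m / n)) ∣-refl)
  where
  open ≡-Reasoning
  m+[n∸m%n]≡[m/n]*n+n : m + (n ∸ m % n) ≡ m / n * n + n
  m+[n∸m%n]≡[m/n]*n+n = begin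
    m + (n ∸ m % n)                    ≡⟨ cong (_+ (n ∸ m % n)) (m≡m%n+[m/n]*n m n) ⟩
    m % n + m / n * n + (n ∸ m % n)    ≡⟨ +-assoc (m % n) (m / n * n) (n ∸ m % n) ⟩
    m % n + (m / n * n + (n ∸ m % n))  ≡⟨ cong (m % n +_) (+-comm (m / n * n) (n ∸ m % n)) ⟩
    m % n + ((n ∸ m % n) + m / n * n)  ≡⟨ +-assoc (m % n) (n ∸ m % n) (m / n * n) ⟨
    m % n + (n ∸ m % n) + m / n * n    ≡⟨ cong (_+ m / n * n) (m+[n∸m]≡n (m%n≤n m n)) ⟩
    n + m / n * n                      ≡⟨ +-comm n (m / n * n) ⟩
    m / n * n + n                      ∎

module OrderGraph {G : Set} (_·_ : G → G → G) (e : G) where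
  open GroupNotions G _·_ e

  IsOrder-unique : ∀ {x k l} → IsOrder x k → IsOrder x l → k ≡ l
  IsOrder-unique {k = k} {l} (0<k , xᵏ≡e , k-least) (0<l , xˡ≡e , l-least) with <-cmp k l
  ... | tri< k<l _ _ = contradiction xᵏ≡e (l-least k 0<k k<l)
  ... | tri≈ _ k≡l _ = k≡l
  ... | tri> _ _ l<k = contradiction xˡ≡e (k-least l 0<l l<k)

  orders⇒≢ : ∀ {x y k l} → IsOrder x k → IsOrder y l → k ≢ l → x ≢ y
  orders⇒≢ ox oy k≢l refl = k≢l (IsOrder-unique ox oy)

  orders⇒SAdj : ∀ {x y k l} → IsOrder x k → IsOrder y l → k ≢ l → Comparable k l → SAdj x y
  orders⇒SAdj ox oy k≢l k∼l = orders⇒≢ ox oy k≢l , _ , _ , ox , oy , k∼l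

  orders⇒nonadjacent : ∀ {x y k l} → IsOrder x k → IsOrder y l → ¬ Comparable k l → x ≢ y × ¬ SAdj x y
  orders⇒nonadjacent ox oy k≁l =
    orders⇒≢ ox oy (λ { refl → k≁l (inj₁ ∣-refl) }) ,
    λ (_ , _ , _ , ox′ , oy′ , k′∼l′) → k≁l (subst₂ Comparable (IsOrder-unique ox′ ox) (IsOrder-unique oy′ oy) k′∼l′)

  orders⇒¬Dominating : ∀ {x y k l} → IsOrder x k → IsOrder y l → ¬ Comparable k l → ¬ Dominating x
  orders⇒¬Dominating ox oy k≁l x-dom =
    let x≢y , x≁y = orders⇒nonadjacent ox oy k≁l in x≁y (x-dom _ (x≢y ∘ sym))

  2^-orders⇒Dominating : (∀ x → ∃[ i ] IsOrder x (2 ^ i)) → ∀ x → Dominating x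
  2^-orders⇒Dominating 2^-order x y y≢x =
    let i , ox = 2^-order x
        j , oy = 2^-order y
    in y≢x ∘ sym , _ , _ , ox , oy , 2^-comparable i j

IsLineGraph-⊥ : ∀ {W : Set} {_≈_ A : W → W → Set} → ¬ W → IsLineGraph W _≈_ A
IsLineGraph-⊥ ¬w = record { Vtx = ⊥ ; Edge = λ _ _ → ⊥ ; sym = λ () ; irrefl = λ () }
                 , (λ w → contradiction w ¬w) , (λ w → contradiction w ¬w)
                 , (λ w → contradiction w ¬w) , (λ ()) , (λ w → contradiction w ¬w)

record Configuration {W : Set} (_≈_ _~_ : W → W → Set) : Set where
  field
    x a b₁ b₂ c₁ c₂ : W
    x~a   : x ~ a
    x~b₁  : x ~ b₁
    x~b₂  : x ~ b₂
    b₁~c₁ : b₁ ~ c₁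
    b₁~c₂ : b₁ ~ c₂
    b₂~c₁ : b₂ ~ c₁
    b₂~c₂ : b₂ ~ c₂
    x≁c₁  : ¬ x ≈ c₁ × ¬ x ~ c₁
    x≁c₂  : ¬ x ≈ c₂ × ¬ x ~ c₂
    a≁b₁  : ¬ a ≈ b₁ × ¬ a ~ b₁
    a≁b₂  : ¬ a ≈ b₂ × ¬ a ~ b₂
    b₁≉b₂ : ¬ b₁ ≈ b₂
    c₁≉c₂ : ¬ c₁ ≈ c₂

module Endpoints {V : Set} where

  infix 4 _∈ₑ_
  _∈ₑ_ : V → V × V → Set
  v ∈ₑ (p , q) = v ≡ p ⊎ v ≡ q

  SameEdge-sym : ∀ {B C : V × V} → SameEdge B C → SameEdge C B
  SameEdge-sym (inj₁ (refl , refl)) = inj₁ (refl , refl)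
  SameEdge-sym (inj₂ (refl , refl)) = inj₂ (refl , refl)

  SameEdge-trans : ∀ {B C D : V × V} → SameEdge B C → SameEdge C D → SameEdge B D
  SameEdge-trans (inj₁ (refl , refl)) C≈D                  = C≈D
  SameEdge-trans (inj₂ (refl , refl)) (inj₁ (refl , refl)) = inj₂ (refl , refl)
  SameEdge-trans (inj₂ (refl , refl)) (inj₂ (refl , refl)) = inj₁ (refl , refl)

  ShareEnd⇒∈ₑ : ∀ (B C : V × V) → ShareEnd B C → ∃[ v ] v ∈ₑ B × v ∈ₑ C
  ShareEnd⇒∈ₑ (p , q) C (inj₁ refl)               = p , inj₁ refl , inj₁ refl
  ShareEnd⇒∈ₑ (p , q) C (inj₂ (inj₁ refl))        = p , inj₁ refl , inj₂ refl
  ShareEnd⇒∈ₑ (p , q) C (inj₂ (inj₂ (inj₁ refl))) = q , inj₂ refl , inj₁ refl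
  ShareEnd⇒∈ₑ (p , q) C (inj₂ (inj₂ (inj₂ refl))) = q , inj₂ refl , inj₂ refl

  ∈ₑ⇒ShareEnd : ∀ {v} (B C : V × V) → v ∈ₑ B → v ∈ₑ C → ShareEnd B C
  ∈ₑ⇒ShareEnd B C (inj₁ refl) (inj₁ refl) = inj₁ refl
  ∈ₑ⇒ShareEnd B C (inj₁ refl) (inj₂ refl) = inj₂ (inj₁ refl)
  ∈ₑ⇒ShareEnd B C (inj₂ refl) (inj₁ refl) = inj₂ (inj₂ (inj₁ refl))
  ∈ₑ⇒ShareEnd B C (inj₂ refl) (inj₂ refl) = inj₂ (inj₂ (inj₂ refl))

  ∈ₑ⇒other-end : ∀ {v} (B : V × V) → v ∈ₑ B → ∃[ w ] SameEdge B (v , w)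
  ∈ₑ⇒other-end (p , q) (inj₁ refl) = q , inj₁ (refl , refl)
  ∈ₑ⇒other-end (p , q) (inj₂ refl) = p , inj₂ (refl , refl)

  ∈ₑ-SameEdge : ∀ {B : V × V} {t s} → SameEdge B (t , s) → t ∈ₑ B
  ∈ₑ-SameEdge (inj₁ (refl , refl)) = inj₁ refl
  ∈ₑ-SameEdge (inj₂ (refl , refl)) = inj₂ refl

  ∈ₑ-pair : ∀ {v} {B : V × V} {t s} → SameEdge B (t , s) → v ∈ₑ B → v ≡ t ⊎ v ≡ s
  ∈ₑ-pair (inj₁ (refl , refl)) v∈B = v∈B
  ∈ₑ-pair (inj₂ (refl , refl)) v∈B = Sum.swap v∈B

  two-∈ₑ : ∀ {v w} (B : V × V) → v ∈ₑ B → w ∈ₑ B → v ≡ w ⊎ SameEdge B (v , w)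
  two-∈ₑ B (inj₁ refl) (inj₁ refl) = inj₁ refl
  two-∈ₑ B (inj₁ refl) (inj₂ refl) = inj₂ (inj₁ (refl , refl))
  two-∈ₑ B (inj₂ refl) (inj₁ refl) = inj₂ (inj₂ (refl , refl))
  two-∈ₑ B (inj₂ refl) (inj₂ refl) = inj₁ refl

  far-end-∈ₑ : ∀ {t s} (X B C : V × V) → t ∈ₑ X → SameEdge B (t , s) → ShareEnd B C → ¬ ShareEnd X C → s ∈ₑ C
  far-end-∈ₑ X B C t∈X B≈ts B∼C X≁C with ShareEnd⇒∈ₑ B C B∼C
  ... | v , v∈B , v∈C with ∈ₑ-pair B≈ts v∈B
  ... | inj₁ refl = contradiction (∈ₑ⇒ShareEnd X C t∈X v∈C) X≁C
  ... | inj₂ refl = v∈C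

  module _ (κ : Configuration {V × V} SameEdge ShareEnd) where
    open Configuration κ

    private
      common-far-end⇒⊥ : ∀ {t₁ t₂ s} → t₁ ∈ₑ x → t₂ ∈ₑ x → SameEdge b₁ (t₁ , s) → SameEdge b₂ (t₂ , s) → ⊥
      common-far-end⇒⊥ t₁∈x t₂∈x b₁≈t₁s b₂≈t₂s with two-∈ₑ x t₁∈x t₂∈x
      ... | inj₁ refl = b₁≉b₂ (SameEdge-trans b₁≈t₁s (SameEdge-sym b₂≈t₂s))
      ... | inj₂ x≈t₁t₂ with ShareEnd⇒∈ₑ x a x~a
      ... | v , v∈x , v∈a with ∈ₑ-pair x≈t₁t₂ v∈x
      ... | inj₁ refl = proj₂ a≁b₁ (∈ₑ⇒ShareEnd a b₁ v∈a (∈ₑ-SameEdge b₁≈t₁s))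
      ... | inj₂ refl = proj₂ a≁b₂ (∈ₑ⇒ShareEnd a b₂ v∈a (∈ₑ-SameEdge b₂≈t₂s))

    -- With t₁, t₂ the endpoints x shares with b₁, b₂, the far endpoints s₁, s₂
    -- of b₁, b₂ lie on both c₁ and c₂; so s₁ = s₂ (else c₁ = s₁s₂ = c₂), and
    -- then x = t₁t₂ makes a meet b₁ or b₂.
    ¬Configuration : ⊥
    ¬Configuration with ShareEnd⇒∈ₑ x b₁ x~b₁ | ShareEnd⇒∈ₑ x b₂ x~b₂
    ... | t₁ , t₁∈x , t₁∈b₁ | t₂ , t₂∈x , t₂∈b₂ with ∈ₑ⇒other-end b₁ t₁∈b₁ | ∈ₑ⇒other-end b₂ t₂∈b₂
    ... | s₁ , b₁≈t₁s₁ | s₂ , b₂≈t₂s₂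
      with two-∈ₑ c₁ (far-end-∈ₑ x b₁ c₁ t₁∈x b₁≈t₁s₁ b₁~c₁ (proj₂ x≁c₁))
                     (far-end-∈ₑ x b₂ c₁ t₂∈x b₂≈t₂s₂ b₂~c₁ (proj₂ x≁c₁))
         | two-∈ₑ c₂ (far-end-∈ₑ x b₁ c₂ t₁∈x b₁≈t₁s₁ b₁~c₂ (proj₂ x≁c₂))
                     (far-end-∈ₑ x b₂ c₂ t₂∈x b₂≈t₂s₂ b₂~c₂ (proj₂ x≁c₂))
    ... | inj₁ refl    | _            = common-far-end⇒⊥ t₁∈x t₂∈x b₁≈t₁s₁ b₂≈t₂s₂
    ... | inj₂ _       | inj₁ refl    = common-far-end⇒⊥ t₁∈x t₂∈x b₁≈t₁s₁ b₂≈t₂s₂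
    ... | inj₂ c₁≈s₁s₂ | inj₂ c₂≈s₁s₂ = c₁≉c₂ (SameEdge-trans c₁≈s₁s₂ (SameEdge-sym c₂≈s₁s₂))

IsLineGraph⇒¬Configuration : ∀ {W : Set} {_≈_ _~_ : W → W → Set} → IsLineGraph W _≈_ _~_ →
                             (∀ {v w} → v ~ w → ¬ v ≈ w) → ¬ Configuration _≈_ _~_
IsLineGraph⇒¬Configuration {_≈_ = _≈_} {_~_} (_ , f , _ , f-injective , _ , ~⇔ShareEnd) ~⇒≉ κ =
  Endpoints.¬Configuration record
    { x = f x ; a = f a ; b₁ = f b₁ ; b₂ = f b₂ ; c₁ = f c₁ ; c₂ = f c₂
    ; x~a = share x~a ; x~b₁ = share x~b₁ ; x~b₂ = share x~b₂
    ; b₁~c₁ = share b₁~c₁ ; b₁~c₂ = share b₁~c₂ ; b₂~c₁ = share b₂~c₁ ; b₂~c₂ = share b₂~c₂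
    ; x≁c₁ = disjoint x≁c₁ ; x≁c₂ = disjoint x≁c₂ ; a≁b₁ = disjoint a≁b₁ ; a≁b₂ = disjoint a≁b₂
    ; b₁≉b₂ = b₁≉b₂ ∘ f-injective _ _ ; c₁≉c₂ = c₁≉c₂ ∘ f-injective _ _
    }
  where
  open Configuration κ
  share : ∀ {v w} → v ~ w → ShareEnd (f v) (f w)
  share v~w = Equivalence.to (~⇔ShareEnd _ _ (~⇒≉ v~w)) v~w
  disjoint : ∀ {v w} → ¬ v ≈ w × ¬ v ~ w → ¬ SameEdge (f v) (f w) × ¬ ShareEnd (f v) (f w)
  disjoint (v≉w , v≁w) = v≉w ∘ f-injective _ _ , v≁w ∘ Equivalence.from (~⇔ShareEnd _ _ v≉w)

module Quaternion (n-1 : ℕ) where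
  n N : ℕ
  n = suc n-1
  N = 2 * n

  e : QElem n
  e = Fin.zero , false

  open GroupNotions (QElem n) (qMul n) e public
  open OrderGraph (qMul n) e public

  a^[_] : ℕ → QElem n
  a^[ r ] = r mod N , false

  toℕ-mod : ∀ r → toℕ (r mod N) ≡ r % N
  toℕ-mod r = toℕ-fromℕ< (m%n<n r N)

  a^[]≡e⇔ : ∀ r → a^[ r ] ≡ e ⇔ N ∣ r
  a^[]≡e⇔ r = mk⇔
    (λ a^r≡e → m%n≡0⇒n∣m r N (trans (sym (toℕ-mod r)) (cong (toℕ ∘ proj₁) a^r≡e)))
    (λ N∣r → cong (_, false) (toℕ-injective (trans (toℕ-mod r) (n∣m⇒m%n≡0 r N N∣r))))

  pow-a : ∀ (j : Fin N) r → pow (j , false) r ≡ a^[ toℕ j * r ]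
  pow-a j zero    = sym (Equivalence.from (a^[]≡e⇔ (toℕ j * 0)) (subst (N ∣_) (sym (*-zeroʳ (toℕ j))) (N ∣0)))
  pow-a j (suc r) = begin
    qMul n (j , false) (pow (j , false) r) ≡⟨ cong (qMul n (j , false)) (pow-a j r) ⟩
    qMul n (j , false) a^[ toℕ j * r ]     ≡⟨ cong (_, false) (toℕ-injective (begin
      toℕ ((toℕ j + toℕ (toℕ j * r mod N)) mod N) ≡⟨ toℕ-mod (toℕ j + toℕ (toℕ j * r mod N)) ⟩
      (toℕ j + toℕ (toℕ j * r mod N)) % N         ≡⟨ cong (λ s → (toℕ j + s) % N) (toℕ-mod (toℕ j * r)) ⟩
      (toℕ j + toℕ j * r % N) % N                 ≡⟨ [m+n%d]%d≡[m+n]%d (toℕ j) (toℕ j * r) N ⟩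
      (toℕ j + toℕ j * r) % N                     ≡⟨ cong (_% N) (*-suc (toℕ j) r) ⟨
      toℕ j * suc r % N                           ≡⟨ toℕ-mod (toℕ j * suc r) ⟨
      toℕ (toℕ j * suc r mod N)                   ∎)) ⟩
    a^[ toℕ j * suc r ]                    ∎
    where open ≡-Reasoning

  pow-a≡e⇔ : ∀ (j : Fin N) r → pow (j , false) r ≡ e ⇔ N ∣ toℕ j * r
  pow-a≡e⇔ j r = subst (λ y → y ≡ e ⇔ N ∣ toℕ j * r) (sym (pow-a j r)) (a^[]≡e⇔ (toℕ j * r))

  IsOrder-a : ∀ (j : Fin N) {g t u} .{{_ : NonZero g}} →
              N ≡ g * t → toℕ j ≡ g * u → Coprime t u → 0 < t → IsOrder (j , false) t
  IsOrder-a j {t = t} N≡gt j≡gu t⊥u 0<t =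
    0<t , from (pow≡e⇔t∣ t) ∣-refl ,
    λ m 0<m m<t aʲᵐ≡e → >⇒∤ {{>-nonZero 0<m}} m<t (to (pow≡e⇔t∣ m) aʲᵐ≡e)
    where
    open Equivalence
    pow≡e⇔t∣ : ∀ m → pow (j , false) m ≡ e ⇔ t ∣ m
    pow≡e⇔t∣ m = ⇔-trans (pow-a≡e⇔ j m)
      (subst₂ (λ p q → p ∣ q * m ⇔ t ∣ m) (sym N≡gt) (sym j≡gu) (g*t∣g*u*m⇔t∣m m t⊥u))

  order-a-∣N : ∀ (j : Fin N) → ∃[ t ] IsOrder (j , false) t × t ∣ N
  order-a-∣N j = N / g , IsOrder-a j N≡g*[N/g] j≡g*[j/g] (coprime-/gcd N (toℕ j)) 0<N/g , m/n∣m g∣N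
    where
    g = gcd N (toℕ j)
    instance
      g≢0 : NonZero g
      g≢0 = ≢-nonZero (gcd[m,n]≢0 N (toℕ j) (inj₁ λ ()))
    g∣N = gcd[m,n]∣m N (toℕ j)
    N≡g*[N/g] : N ≡ g * (N / g)
    N≡g*[N/g] = sym (m*[n/m]≡n g∣N)
    j≡g*[j/g] : toℕ j ≡ g * (toℕ j / g)
    j≡g*[j/g] = sym (m*[n/m]≡n (gcd[m,n]∣n N (toℕ j)))
    0<N/g : 0 < N / g
    0<N/g = n≢0⇒n>0 (m/gcd[m,n]≢0 N (toℕ j))

  n<N : n < N
  n<N = m<m+n n z<s

  N∸n≡n : N ∸ n ≡ n
  N∸n≡n = trans (m+n∸m≡n n (n + 0)) (+-identityʳ n)

  -- qMul writes a⁻ᵏ as a^(N ∸ k), so n∣m+[n∸m%n] is the identity aᵐ a⁻ᵐ = e.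
  IsOrder-b : ∀ (i : Fin N) → IsOrder (i , true) 4
  IsOrder-b i = z<s , cong (_, false) (toℕ-injective b⁴≡e) , λ where
      1 _ _ ()
      2 _ _ b²≡e → contradiction (trans (sym b²≡aⁿ) (cong (toℕ ∘ proj₁) b²≡e)) λ ()
      3 _ _ ()
      (suc (suc (suc (suc _)))) _ (s≤s (s≤s (s≤s (s≤s ()))))
    where
    open ≡-Reasoning
    b : QElem n
    b = i , true
    i′ = toℕ i

    b¹ : toℕ (proj₁ (pow b 1)) ≡ i′ % N
    b¹ = trans (toℕ-mod (i′ + N)) ([m+n]%n≡m%n i′ N)

    b²≡aⁿ : toℕ (proj₁ (pow b 2)) ≡ n
    b²≡aⁿ = begin
      toℕ ((i′ + (N ∸ toℕ (proj₁ (pow b 1))) + n) mod N) ≡⟨ toℕ-mod (i′ + (N ∸ toℕ (proj₁ (pow b 1))) + n) ⟩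
      (i′ + (N ∸ toℕ (proj₁ (pow b 1))) + n) % N         ≡⟨ cong (λ r → (i′ + (N ∸ r) + n) % N) b¹ ⟩
      (i′ + (N ∸ i′ % N) + n) % N                        ≡⟨ %-remove-+ˡ n (n∣m+[n∸m%n] i′ N) ⟩
      n % N                                              ≡⟨ m<n⇒m%n≡m n<N ⟩
      n                                                  ∎

    b³ : toℕ (proj₁ (pow b 3)) ≡ (i′ + n) % N
    b³ = begin
      toℕ ((i′ + (N ∸ toℕ (proj₁ (pow b 2)))) mod N) ≡⟨ toℕ-mod (i′ + (N ∸ toℕ (proj₁ (pow b 2)))) ⟩
      (i′ + (N ∸ toℕ (proj₁ (pow b 2)))) % N         ≡⟨ cong (λ r → (i′ + (N ∸ r)) % N) b²≡aⁿ ⟩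
      (i′ + (N ∸ n)) % N                             ≡⟨ cong (λ r → (i′ + r) % N) N∸n≡n ⟩
      (i′ + n) % N                                   ∎

    b⁴≡e : toℕ (proj₁ (pow b 4)) ≡ 0
    b⁴≡e = begin
      toℕ ((i′ + (N ∸ toℕ (proj₁ (pow b 3))) + n) mod N) ≡⟨ toℕ-mod (i′ + (N ∸ toℕ (proj₁ (pow b 3))) + n) ⟩
      (i′ + (N ∸ toℕ (proj₁ (pow b 3))) + n) % N         ≡⟨ cong (λ r → (i′ + (N ∸ r) + n) % N) b³ ⟩
      (i′ + w + n) % N                                   ≡⟨ cong (_% N) (+-assoc i′ w n) ⟩
      (i′ + (w + n)) % N                                 ≡⟨ cong (λ r → (i′ + r) % N) (+-comm w n) ⟩
      (i′ + (n + w)) % N                                 ≡⟨ cong (_% N) (+-assoc i′ n w) ⟨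
      (i′ + n + w) % N                                   ≡⟨ n∣m⇒m%n≡0 (i′ + n + w) N (n∣m+[n∸m%n] (i′ + n) N) ⟩
      0                                                  ∎
      where w = N ∸ (i′ + n) % N

  g*u<N : ∀ {g t u} .{{_ : NonZero g}} → N ≡ g * t → u < t → g * u < N
  g*u<N {g} {t} {u} N≡gt u<t = subst (g * u <_) (sym N≡gt) (*-monoʳ-< g u<t)

  IsOrder-a^ : ∀ {g t u} .{{_ : NonZero g}} → N ≡ g * t → u < t → Coprime t u → IsOrder a^[ g * u ] t
  IsOrder-a^ {g} {t} {u} N≡gt u<t t⊥u =
    IsOrder-a (g * u mod N) N≡gt (trans (toℕ-mod (g * u)) (m<n⇒m%n≡m (g*u<N N≡gt u<t))) t⊥u (≤-<-trans z≤n u<t)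

  a^[g*]-injective : ∀ {g t u v} .{{_ : NonZero g}} → N ≡ g * t → u < t → v < t → a^[ g * u ] ≡ a^[ g * v ] → u ≡ v
  a^[g*]-injective {g} {t} {u} {v} N≡gt u<t v<t a^gu≡a^gv = *-cancelˡ-≡ u v g (begin
    g * u               ≡⟨ m<n⇒m%n≡m (g*u<N N≡gt u<t) ⟨
    g * u % N           ≡⟨ toℕ-mod (g * u) ⟨
    toℕ (g * u mod N)   ≡⟨ cong (toℕ ∘ proj₁) a^gu≡a^gv ⟩
    toℕ (g * v mod N)   ≡⟨ toℕ-mod (g * v) ⟩
    g * v % N           ≡⟨ m<n⇒m%n≡m (g*u<N N≡gt v<t) ⟩
    g * v               ∎)
    where open ≡-Reasoning

  2^-orders : ∀ {k} → n ≡ 2 ^ k → ∀ x → ∃[ i ] IsOrder x (2 ^ i)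
  2^-orders {k} n≡2^k (j , false) with order-a-∣N j
  ... | t , aʲ-order , t∣N with ∣2^⇒≡2^ (suc k) (subst (t ∣_) (cong (2 *_) n≡2^k) t∣N)
  ... | i , refl = i , aʲ-order
  2^-orders _ (i , true) = 2 , IsOrder-b i

  2^⇒IsLineGraph : ∀ {k} → n ≡ 2 ^ k → IsLineGraph V** _≈**_ Adj**
  2^⇒IsLineGraph {k} n≡2^k = IsLineGraph-⊥ λ (x , x-not-dominating) →
    x-not-dominating (2^-orders⇒Dominating (2^-orders {k} n≡2^k) x)

  module OddDivisor {c d : ℕ} (n≡c*d : n ≡ c * d) (2<d : 2 < d) (2∤d : 2 ∤ d) where
    private
      instance
        c≢0 : NonZero c
        c≢0 = m*n≢0⇒m≢0 c {{subst NonZero n≡c*d _}}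
        2c≢0 : NonZero (2 * c)
        2c≢0 = m*n≢0 2 c
        d≢0 : NonZero d
        d≢0 = >-nonZero (<-trans z<s 2<d)
        2d≢0 : NonZero (2 * d)
        2d≢0 = m*n≢0 2 d

      N≡n*2 : N ≡ n * 2
      N≡n*2 = *-comm 2 n

      N≡2c*d : N ≡ 2 * c * d
      N≡2c*d = trans (cong (2 *_) n≡c*d) (sym (*-assoc 2 c d))

      N≡c*2d : N ≡ c * (2 * d)
      N≡c*2d = trans N≡2c*d (trans (cong (_* d) (*-comm 2 c)) (*-assoc c 2 d))

      1<d : 1 < d
      1<d = <-trans ≤-refl 2<d

      2≁d : ¬ Comparable 2 d
      2≁d (inj₁ 2∣d) = 2∤d 2∣d
      2≁d (inj₂ d∣2) = <⇒≱ 2<d (∣⇒≤ d∣2)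

      4≁d : ¬ Comparable 4 d
      4≁d (inj₁ 4∣d) = 2∤d (∣-trans (divides 2 refl) 4∣d)
      4≁d (inj₂ d∣4) = <⇒≱ 2<d (∣⇒≤ (coprime-divisor (∤⇒coprime-2 2∤d) d∣4))

      4≁2d : ¬ Comparable 4 (2 * d)
      4≁2d (inj₁ 4∣2d) = 2∤d (*-cancelˡ-∣ 2 4∣2d)
      4≁2d (inj₂ 2d∣4) = <⇒≱ 2<d (*-cancelˡ-≤ 2 (∣⇒≤ 2d∣4))

      2≢2d : 2 ≢ 2 * d
      2≢2d = <⇒≢ (*-monoʳ-< 2 1<d)

      2d≢d : 2 * d ≢ d
      2d≢d 2d≡d = 2∤d (subst (2 ∣_) 2d≡d (m∣m*n d))

      -- a^[ c * pred (2 * d) ] = a^(-c) and a^[ 2 * c * pred d ] = a^(-2c).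
      x-order : IsOrder a^[ n * 1 ] 2
      x-order = IsOrder-a^ {n} N≡n*2 ≤-refl (coprime-sym (1-coprimeTo 2))

      a-order : IsOrder (Fin.zero , true) 4
      a-order = IsOrder-b Fin.zero

      b₁-order : IsOrder a^[ c * 1 ] (2 * d)
      b₁-order = IsOrder-a^ N≡c*2d (m≤m*n 2 d) (coprime-sym (1-coprimeTo _))

      b₂-order : IsOrder a^[ c * pred (2 * d) ] (2 * d)
      b₂-order = IsOrder-a^ N≡c*2d (pred[n]<n (2 * d)) (coprime-pred (2 * d))

      c₁-order : IsOrder a^[ 2 * c * 1 ] d
      c₁-order = IsOrder-a^ N≡2c*d 1<d (coprime-sym (1-coprimeTo d))

      c₂-order : IsOrder a^[ 2 * c * pred d ] d
      c₂-order = IsOrder-a^ N≡2c*d (pred[n]<n d) (coprime-pred d)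

      vertex : ∀ {x y k l} → IsOrder x k → IsOrder y l → ¬ Comparable k l → V**
      vertex ox oy k≁l = _ , orders⇒¬Dominating ox oy k≁l

    configuration : Configuration _≈**_ Adj**
    configuration = record
      { x = vertex x-order c₁-order 2≁d
      ; a = vertex a-order c₁-order 4≁d
      ; b₁ = vertex b₁-order a-order (4≁2d ∘ Sum.swap)
      ; b₂ = vertex b₂-order a-order (4≁2d ∘ Sum.swap)
      ; c₁ = vertex c₁-order a-order (4≁d ∘ Sum.swap)
      ; c₂ = vertex c₂-order a-order (4≁d ∘ Sum.swap)
      ; x~a = orders⇒SAdj x-order a-order (λ ()) (inj₁ (divides 2 refl))
      ; x~b₁ = orders⇒SAdj x-order b₁-order 2≢2d (inj₁ (m∣m*n d))
      ; x~b₂ = orders⇒SAdj x-order b₂-order 2≢2d (inj₁ (m∣m*n d))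
      ; b₁~c₁ = orders⇒SAdj b₁-order c₁-order 2d≢d (inj₂ (n∣m*n 2))
      ; b₁~c₂ = orders⇒SAdj b₁-order c₂-order 2d≢d (inj₂ (n∣m*n 2))
      ; b₂~c₁ = orders⇒SAdj b₂-order c₁-order 2d≢d (inj₂ (n∣m*n 2))
      ; b₂~c₂ = orders⇒SAdj b₂-order c₂-order 2d≢d (inj₂ (n∣m*n 2))
      ; x≁c₁ = orders⇒nonadjacent x-order c₁-order 2≁d
      ; x≁c₂ = orders⇒nonadjacent x-order c₂-order 2≁d
      ; a≁b₁ = orders⇒nonadjacent a-order b₁-order 4≁2d
      ; a≁b₂ = orders⇒nonadjacent a-order b₂-order 4≁2d
      ; b₁≉b₂ = 2<⇒1≢pred (<-≤-trans 2<d (m≤n*m d 2)) ∘ a^[g*]-injective N≡c*2d (m≤m*n 2 d) (pred[n]<n (2 * d))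
      ; c₁≉c₂ = 2<⇒1≢pred 2<d ∘ a^[g*]-injective N≡2c*d 1<d (pred[n]<n d)
      }

    ¬IsLineGraph : ¬ IsLineGraph V** _≈**_ Adj**
    ¬IsLineGraph L = IsLineGraph⇒¬Configuration L proj₁ configuration

mainTheorem7 : (n : ℕ) → (h : 2 ≤ n) →
    SQ**IsLineGraph n h ⇔ (∃ λ k → (1 ≤ k) × (n ≡ 2 ^ k))
mainTheorem7 (suc n-1) 1<n = mk⇔ to from
  where
  open Quaternion n-1
  from : ∃[ k ] 1 ≤ k × n ≡ 2 ^ k → IsLineGraph V** _≈**_ Adj**
  from (k , _ , n≡2^k) = 2^⇒IsLineGraph {k} n≡2^k
  to : IsLineGraph V** _≈**_ Adj** → ∃[ k ] 1 ≤ k × n ≡ 2 ^ k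
  to L with 2^⊎odd-divisor n z<s
  ... | inj₁ (zero , n≡1)    = contradiction (sym n≡1) (<⇒≢ 1<n)
  ... | inj₁ (suc k , n≡2^k) = suc k , s≤s z≤n , n≡2^k
  ... | inj₂ (d , 2<d , 2∤d , divides c n≡c*d) = contradiction L (OddDivisor.¬IsLineGraph {c} n≡c*d 2<d 2∤d)
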